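{- If $\{A_n:n\in\omega\}$ is a collection of infinite antichains in $\omega^{<\omega}$, then there is an antichain $B\subseteq\omega^{<\omega}$ such that $B\cap A_n$ is infinite for infinitely many $n\in\omega$.
   Context: $\omega^{<\omega}$ is ordered by end-extension; an antichain is a set of pairwise incomparable elements. -}

module Defs where

open import Data.Nat using (ℕ)
open import Data.List using (List; _++_)
open import Data.List.Membership.Propositional using (_∈_)
open import Data.Product using (Σ; ∃; _×_)
open import Data.Sum using (_⊎_)
open import Relation.Binary.PropositionalEquality using (_≡_; _≢_)
open import Relation.Nullary using (¬_)

Seq : Set
Seq = List ℕ

_⊑_ : Seq → Seq → Set
s ⊑ t = ∃ λ (u : Seq) → s ++ u ≡ t

Comparable : Seq → Seq → Set
Comparable s t = s ⊑ t ⊎ t ⊑ s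

Antichain : (Seq → Set) → Set
Antichain A = ∀ s t → A s → A t → s ≢ t → ¬ Comparable s t

Finite : {X : Set} → (X → Set) → Set
Finite {X} P = ∃ λ (xs : List X) → ∀ x → P x → x ∈ xs

Infinite : {X : Set} → (X → Set) → Set
Infinite P = ¬ Finite P

-- Build B as the union of an increasing sequence of finite antichains, keeping track of a
-- shrinking infinite set of candidate indices n for which infinitely many elements of A n
-- are still incomparable with everything chosen so far. At stage k a candidate n ≥ k is
-- committed, and for every committed index one new element of its antichain is added.
-- The choice is possible because of a tree property of ω^{<ω}: an element comparable with
-- two incomparable nodes is a prefix of one of them, so of any two incomparable new
-- elements at least one keeps a given index alive; hence each committed index rules out at
-- most one element, and each remaining candidate is kept by one of two fixed choices.
module Submission where

open import Defs
open import Data.Nat using (ℕ; zero; suc; _≤_; _⊔_; _≤′_; ≤′-refl; ≤′-step)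
open import Data.Nat.Properties using (≤-refl; <⇒≱; ≰⇒>; ≤⇒≤′; m≤m⊔n; m≤n⊔m)
open import Data.List using (List; []; _∷_; _++_; inits; upTo)
open import Data.List.Properties using (++-identityʳ; ∷-injective)
open import Data.List.Extrema.Nat using (max; xs≤max)
open import Data.List.Membership.Propositional using (_∈_; _∉_)
open import Data.List.Membership.Propositional.Properties
  using (∈-map⁺; ∈-++⁺ˡ; ∈-++⁺ʳ; []∈inits; ∈-upTo⁺)
open import Data.List.Relation.Unary.Any using (here; there)
open import Data.List.Relation.Unary.All as All using (All; []; _∷_)
open import Data.List.Relation.Unary.AllPairs using (AllPairs; []; _∷_)
open import Data.Product using (∃; ∃₂; _×_; _,_; proj₁; proj₂; map₂)
open import Data.Sum using (_⊎_; inj₁; inj₂; [_,_]′; swap)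
import Data.Sum as Sum
open import Data.Empty using (⊥-elim)
open import Data.Unit using (⊤; tt)
open import Function using (_∘_; id)
open import Level using (0ℓ)
open import Relation.Binary.Core using (Rel)
open import Relation.Binary.Definitions using (Symmetric)
open import Relation.Binary.PropositionalEquality using (_≡_; _≢_; refl; sym; cong₂)
open import Relation.Nullary using (¬_; yes; no)
open import Relation.Unary using (Pred; _⊆_; _∪_; _∩_; _∖_; Satisfiable)
open import Axiom.ExcludedMiddle using (ExcludedMiddle)
open import Axiom.DoubleNegationElimination using (DoubleNegationElimination; em⇒dne)

private
  variable
    X I : Set
    P Q : Pred X 0ℓ
    R : Rel X 0ℓ
    x y : X
    xs : List X
    s t x₁ x₂ : Seq

AllPairs-lookup : Symmetric R → AllPairs R xs → x ∈ xs → y ∈ xs → x ≢ y → R x y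
AllPairs-lookup _   (_ ∷ _)    (here refl) (here refl) x≢y = ⊥-elim (x≢y refl)
AllPairs-lookup _   (Rx ∷ _)   (here refl) (there y∈) _   = All.lookup Rx y∈
AllPairs-lookup sym (Ry ∷ _)   (there x∈)  (here refl) _   = sym (All.lookup Ry x∈)
AllPairs-lookup sym (_ ∷ Rxs)  (there x∈)  (there y∈) x≢y = AllPairs-lookup sym Rxs x∈ y∈ x≢y

_∥_ : Seq → Seq → Set
s ∥ t = ¬ Comparable s t

∥-sym : Symmetric _∥_
∥-sym s∥t = s∥t ∘ swap

Comparable-refl : Comparable s s
Comparable-refl {s} = inj₁ ([] , ++-identityʳ s)

⊑-finite : Finite (_⊑ t)
⊑-finite {t} = inits t , λ s s⊑t → ⊑⇒∈-inits s⊑t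
  where
  ++-∈-inits : ∀ s u → s ∈ inits (s ++ u)
  ++-∈-inits []      u = []∈inits u
  ++-∈-inits (a ∷ s) u = there (∈-map⁺ (a ∷_) (++-∈-inits s u))

  ⊑⇒∈-inits : s ⊑ t → s ∈ inits t
  ⊑⇒∈-inits {s} (u , refl) = ++-∈-inits s u

common-extension⇒comparable : x₁ ⊑ s → x₂ ⊑ s → Comparable x₁ x₂
common-extension⇒comparable (u₁ , refl) (u₂ , eq) = comparable _ _ u₁ u₂ (sym eq)
  where
  comparable : ∀ x₁ x₂ u₁ u₂ → x₁ ++ u₁ ≡ x₂ ++ u₂ → Comparable x₁ x₂
  comparable []       x₂       _  _  _  = inj₁ (x₂ , refl)
  comparable (a ∷ x₁) []       _  _  _  = inj₂ (a ∷ x₁ , refl)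
  comparable (a ∷ x₁) (b ∷ x₂) u₁ u₂ eq with ∷-injective eq
  ... | a≡b , eq′ = Sum.map (map₂ (cong₂ _∷_ a≡b)) (map₂ (cong₂ _∷_ (sym a≡b)))
                            (comparable x₁ x₂ u₁ u₂ eq′)

comparable-to-both⇒prefix : x₁ ∥ x₂ → Comparable s x₁ → Comparable s x₂ → s ⊑ x₁ ⊎ s ⊑ x₂
comparable-to-both⇒prefix _     (inj₁ s⊑x₁) _           = inj₁ s⊑x₁
comparable-to-both⇒prefix _     (inj₂ _)    (inj₁ s⊑x₂) = inj₂ s⊑x₂
comparable-to-both⇒prefix x₁∥x₂ (inj₂ x₁⊑s) (inj₂ x₂⊑s) =
  ⊥-elim (x₁∥x₂ (common-extension⇒comparable x₁⊑s x₂⊑s))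

Finite-⊆ : P ⊆ Q → Finite Q → Finite P
Finite-⊆ P⊆Q (xs , Q⊆xs) = xs , λ x Px → Q⊆xs x (P⊆Q Px)

Infinite-⊆ : P ⊆ Q → Infinite P → Infinite Q
Infinite-⊆ P⊆Q infP = infP ∘ Finite-⊆ P⊆Q

Finite-∪ : Finite P → Finite Q → Finite (P ∪ Q)
Finite-∪ (xs , P⊆xs) (ys , Q⊆ys) = xs ++ ys , λ x → [ ∈-++⁺ˡ ∘ P⊆xs x , ∈-++⁺ʳ xs ∘ Q⊆ys x ]′

Infinite-∪-Finite : Infinite (P ∪ Q) → Finite Q → Infinite P
Infinite-∪-Finite inf finQ finP = inf (Finite-∪ finP finQ)

escapes⇒Infinite : (∀ xs → ∃ λ x → P x × x ∉ xs) → Infinite P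
escapes⇒Infinite escape (xs , P⊆xs) with escape xs
... | x , Px , x∉xs = x∉xs (P⊆xs x Px)

unbounded⇒Infinite : {P : Pred ℕ 0ℓ} → (∀ k → ∃ λ n → k ≤ n × P n) → Infinite P
unbounded⇒Infinite unbounded (ns , P⊆ns) with unbounded (suc (max 0 ns))
... | n , max<n , Pn = <⇒≱ max<n (All.lookup (xs≤max 0 ns) (P⊆ns n Pn))

AtMostOne : Pred X 0ℓ → Set
AtMostOne P = ∀ {x y} → P x → P y → x ≡ y

module Classical (em : ExcludedMiddle 0ℓ) where

  dne : DoubleNegationElimination 0ℓ
  dne = em⇒dne em

  Infinite-∪⁻ : Infinite (P ∪ Q) → Infinite P ⊎ Infinite Q
  Infinite-∪⁻ {P = P} inf with em {Infinite P}
  ... | yes infP = inj₁ infP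
  ... | no ¬infP = inj₂ λ finQ → inf (Finite-∪ (dne ¬infP) finQ)

  Infinite⇒escapes : Infinite P → ∀ xs → ∃ λ x → P x × x ∉ xs
  Infinite⇒escapes inf xs = dne λ ∄ → inf (xs , λ x Px → dne λ x∉xs → ∄ (x , Px , x∉xs))

  Infinite⇒distinct : Infinite P → ∃₂ λ x y → P x × P y × x ≢ y
  Infinite⇒distinct inf with Infinite⇒escapes inf []
  ... | x , Px , _ with Infinite⇒escapes inf (x ∷ [])
  ... | y , Py , y∉[x] = x , y , Px , Py , λ x≡y → y∉[x] (here (sym x≡y))

  Infinite⇒unbounded : {P : Pred ℕ 0ℓ} → Infinite P → ∀ k → ∃ λ n → k ≤ n × P n
  Infinite⇒unbounded inf k =
    dne λ ∄ → inf (upTo k , λ n Pn → ∈-upTo⁺ (≰⇒> λ k≤n → ∄ (n , k≤n , Pn)))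

  AtMostOne⇒Finite : AtMostOne P → Finite P
  AtMostOne⇒Finite {P = P} unique with em {Satisfiable P}
  ... | yes (x , Px) = x ∷ [] , λ y Py → here (unique Py Px)
  ... | no ∄         = [] , λ y Py → ⊥-elim (∄ (y , Py))

  Infinite-∩ : Infinite P → Finite (P ∖ Q) → Infinite (P ∩ Q)
  Infinite-∩ {P = P} {Q = Q} inf fin = Infinite-∪-Finite (Infinite-⊆ split inf) fin
    where
    split : P ⊆ (P ∩ Q) ∪ (P ∖ Q)
    split {x} Px with em {Q x}
    ... | yes Qx = inj₁ (Px , Qx)
    ... | no ¬Qx = inj₂ (Px , ¬Qx)

  Infinite-∩-All : {Q : I → Pred X 0ℓ} (is : List I) → Infinite P →
                   (∀ {i} → i ∈ is → Finite (P ∖ Q i)) →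
                   Infinite (P ∩ λ x → All (λ i → Q i x) is)
  Infinite-∩-All []       inf _   = Infinite-⊆ (_, []) inf
  Infinite-∩-All (i ∷ is) inf fin =
    Infinite-⊆ (λ ((Px , Qis) , Qi) → Px , Qi ∷ Qis)
      (Infinite-∩ (Infinite-∩-All is inf (fin ∘ there))
                  (Finite-⊆ (λ ((Px , _) , ¬Qi) → Px , ¬Qi) (fin (here refl))))

module Chain (L : ℕ → List X) (L-grows : ∀ k → (_∈ L k) ⊆ (_∈ L (suc k))) where

  Union : Pred X 0ℓ
  Union x = ∃ λ k → x ∈ L k

  mono : ∀ {k l} → k ≤ l → (_∈ L k) ⊆ (_∈ L l)
  mono k≤l = mono′ (≤⇒≤′ k≤l)
    where
    mono′ : ∀ {k l} → k ≤′ l → (_∈ L k) ⊆ (_∈ L l)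
    mono′ ≤′-refl          = id
    mono′ (≤′-step k≤′l) = L-grows _ ∘ mono′ k≤′l

  Union-pairwise : Symmetric R → (∀ k → AllPairs R (L k)) →
                   Union x → Union y → x ≢ y → R x y
  Union-pairwise sym pairwise (k , x∈) (l , y∈) =
    AllPairs-lookup sym (pairwise (k ⊔ l)) (mono (m≤m⊔n k l) x∈) (mono (m≤n⊔m k l) y∈)

  Union-bounded : ExcludedMiddle 0ℓ → (ys : List X) →
                  ∃ λ K → (λ y → y ∈ ys × Union y) ⊆ (_∈ L K)
  Union-bounded em []       = 0 , λ ()
  Union-bounded em (y ∷ ys) with Union-bounded em ys | em {Union y}
  ... | K , below | yes (k , y∈) = K ⊔ k , λ
    { (here refl , _) → mono (m≤n⊔m K k) y∈
    ; (there y∈ys , u) → mono (m≤m⊔n K k) (below (y∈ys , u)) }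
  ... | K , below | no ¬u = K , λ
    { (here refl , u) → ⊥-elim (¬u u)
    ; (there y∈ys , u) → below (y∈ys , u) }

module Construction (em : ExcludedMiddle 0ℓ) (A : ℕ → Seq → Set)
  (A-antichain : ∀ n → Antichain (A n)) (A-infinite : ∀ n → Infinite (A n)) where

  open Classical em

  Avoiding : List Seq → ℕ → Pred Seq 0ℓ
  Avoiding B n = A n ∩ λ x → All (x ∥_) B

  Fresh : List Seq → Pred ℕ 0ℓ
  Fresh B n = Infinite (Avoiding B n)

  fresh-split : ∀ {B n} → Fresh B n → x₁ ∥ x₂ → Fresh (x₁ ∷ B) n ⊎ Fresh (x₂ ∷ B) n
  fresh-split {x₁} {x₂} {B} {n} fresh x₁∥x₂ =
    Infinite-∪⁻ (Infinite-∪-Finite (Infinite-⊆ cover fresh) (Finite-∪ ⊑-finite ⊑-finite))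
    where
    cover : Avoiding B n ⊆ (Avoiding (x₁ ∷ B) n ∪ Avoiding (x₂ ∷ B) n) ∪ ((_⊑ x₁) ∪ (_⊑ x₂))
    cover {s} (As , s∥B) with em {Comparable s x₁} | em {Comparable s x₂}
    ... | no s∥x₁  | _        = inj₁ (inj₁ (As , s∥x₁ ∷ s∥B))
    ... | yes _    | no s∥x₂  = inj₁ (inj₂ (As , s∥x₂ ∷ s∥B))
    ... | yes s~x₁ | yes s~x₂ = inj₂ (comparable-to-both⇒prefix x₁∥x₂ s~x₁ s~x₂)

  spoilers-finite : ∀ {B n c} → Fresh B n → Finite (Avoiding B c ∖ λ x → Fresh (x ∷ B) n)
  spoilers-finite {c = c} fresh = AtMostOne⇒Finite λ ((Ax , _) , ¬fx) ((Ay , _) , ¬fy) →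
    dne λ x≢y → [ ¬fx , ¬fy ]′ (fresh-split fresh (A-antichain c _ _ Ax Ay x≢y))

  record Stage (C : List ℕ) : Set₁ where
    field
      chosen              : List Seq
      candidates          : Pred ℕ 0ℓ
      chosen-antichain    : AllPairs _∥_ chosen
      committed-fresh     : All (Fresh chosen) C
      candidates-fresh    : candidates ⊆ Fresh chosen
      candidates-infinite : Infinite candidates

  open Stage

  record Extension {C : List ℕ} (S : Stage C) (c : ℕ) : Set where
    field
      new                : Seq
      new-avoiding       : Avoiding (chosen S) c new
      committed-stay     : All (Fresh (new ∷ chosen S)) C
      candidates-stay    : Infinite (candidates S ∩ Fresh (new ∷ chosen S))

  open Extension

  Viable : ∀ {C} → Stage C → ℕ → Pred Seq 0ℓ
  Viable {C} S c = Avoiding (chosen S) c ∩ λ x → All (Fresh (x ∷ chosen S)) C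

  Viable-infinite : ∀ {C c} (S : Stage C) → Fresh (chosen S) c → Infinite (Viable S c)
  Viable-infinite {C} S fresh-c = Infinite-∩-All C fresh-c
    (λ i∈C → spoilers-finite (All.lookup (committed-fresh S) i∈C))

  choose : ∀ {C c} (S : Stage C) → Fresh (chosen S) c → Extension S c
  choose {C} {c} S fresh-c with Infinite⇒distinct (Viable-infinite S fresh-c)
  ... | x₁ , x₂ , (Ax₁ , fresh₁) , (Ax₂ , fresh₂) , x₁≢x₂ =
    [ extension Ax₁ fresh₁ , extension Ax₂ fresh₂ ]′
      (Infinite-∪⁻ (Infinite-⊆ split (candidates-infinite S)))
    where
    x₁∥x₂ : x₁ ∥ x₂
    x₁∥x₂ = A-antichain c x₁ x₂ (proj₁ Ax₁) (proj₁ Ax₂) x₁≢x₂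

    split : candidates S ⊆
            (candidates S ∩ Fresh (x₁ ∷ chosen S)) ∪ (candidates S ∩ Fresh (x₂ ∷ chosen S))
    split cand = Sum.map (cand ,_) (cand ,_) (fresh-split (candidates-fresh S cand) x₁∥x₂)

    extension : ∀ {x} → Avoiding (chosen S) c x → All (Fresh (x ∷ chosen S)) C →
                Infinite (candidates S ∩ Fresh (x ∷ chosen S)) → Extension S c
    extension {x} Ax fresh inf = record
      { new = x ; new-avoiding = Ax ; committed-stay = fresh ; candidates-stay = inf }

  extend : ∀ {C c} {S : Stage C} → Extension S c → Stage C
  extend {S = S} E = record
    { chosen              = new E ∷ chosen S
    ; candidates          = candidates S ∩ Fresh (new E ∷ chosen S)
    ; chosen-antichain    = proj₂ (new-avoiding E) ∷ chosen-antichain S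
    ; committed-fresh     = committed-stay E
    ; candidates-fresh    = proj₂
    ; candidates-infinite = candidates-stay E
    }

  extend-all : ∀ {C} → Stage C → (D : List ℕ) → (_∈ D) ⊆ (_∈ C) → Stage C
  extend-all S []      _    = S
  extend-all S (d ∷ D) D⊆C = extend-all (extend E) D (D⊆C ∘ there)
    where E = choose S (All.lookup (committed-fresh S) (D⊆C (here refl)))

  extend-all-⊇ : ∀ {C} (S : Stage C) D (D⊆C : (_∈ D) ⊆ (_∈ C)) →
                 (_∈ chosen S) ⊆ (_∈ chosen (extend-all S D D⊆C))
  extend-all-⊇ S []      _    = id
  extend-all-⊇ S (d ∷ D) D⊆C = extend-all-⊇ _ D (D⊆C ∘ there) ∘ there

  extend-all-meets : ∀ {C c} (S : Stage C) D (D⊆C : (_∈ D) ⊆ (_∈ C)) → c ∈ D →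
                     ∃ λ x → x ∈ chosen (extend-all S D D⊆C) × Avoiding (chosen S) c x
  extend-all-meets S (d ∷ D) D⊆C (here refl) =
    new E , extend-all-⊇ (extend E) D (D⊆C ∘ there) (here refl) , new-avoiding E
    where E = choose S (All.lookup (committed-fresh S) (D⊆C (here refl)))
  extend-all-meets S (d ∷ D) D⊆C (there c∈D) =
    map₂ (map₂ (map₂ All.tail)) (extend-all-meets _ D (D⊆C ∘ there) c∈D)

  commit : ∀ {C n} (S : Stage C) → candidates S n → Stage (n ∷ C)
  commit S cand = record
    { chosen              = chosen S
    ; candidates          = candidates S
    ; chosen-antichain    = chosen-antichain S
    ; committed-fresh     = candidates-fresh S cand ∷ committed-fresh S
    ; candidates-fresh    = candidates-fresh S
    ; candidates-infinite = candidates-infinite S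
    }

  initial : Stage []
  initial = record
    { chosen              = []
    ; candidates          = λ _ → ⊤
    ; chosen-antichain    = []
    ; committed-fresh     = []
    ; candidates-fresh    = λ {n} _ → Infinite-⊆ (_, []) (A-infinite n)
    ; candidates-infinite = unbounded⇒Infinite λ k → k , ≤-refl , tt
    }

  committed  : ℕ → List ℕ
  stage      : (k : ℕ) → Stage (committed k)
  next       : (k : ℕ) → ∃ λ n → k ≤ n × candidates (stage k) n
  committing : (k : ℕ) → Stage (committed (suc k))

  target : ℕ → ℕ
  target k = proj₁ (next k)

  committed zero    = []
  committed (suc k) = target k ∷ committed k

  stage zero    = initial
  stage (suc k) = extend-all (committing k) (committed (suc k)) id

  next k = Infinite⇒unbounded (candidates-infinite (stage k)) k

  committing k = commit (stage k) (proj₂ (proj₂ (next k)))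

  open Chain (λ k → chosen (stage k)) (λ k → extend-all-⊇ (committing k) (committed (suc k)) id)
    public renaming (Union to Chosen)

  Chosen-antichain : Antichain Chosen
  Chosen-antichain _ _ = Union-pairwise ∥-sym (λ k → chosen-antichain (stage k))

  target-committed : ∀ {i m} → i ≤ m → target i ∈ committed (suc m)
  target-committed i≤m = target-committed′ (≤⇒≤′ i≤m)
    where
    target-committed′ : ∀ {i m} → i ≤′ m → target i ∈ committed (suc m)
    target-committed′ ≤′-refl          = here refl
    target-committed′ (≤′-step i≤′m) = there (target-committed′ i≤′m)

  stage-meets : ∀ {i m} → i ≤ m →
                ∃ λ x → x ∈ chosen (stage (suc m)) × Avoiding (chosen (stage m)) (target i) x
  stage-meets {m = m} i≤m =
    extend-all-meets (committing m) (committed (suc m)) id (target-committed i≤m)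

  Chosen-meets-target : ∀ i → Infinite (Chosen ∩ A (target i))
  Chosen-meets-target i = escapes⇒Infinite λ ys → escape ys (Union-bounded em ys)
    where
    escape : ∀ ys → (∃ λ K → (λ y → y ∈ ys × Chosen y) ⊆ (_∈ chosen (stage K))) →
             ∃ λ s → (Chosen ∩ A (target i)) s × s ∉ ys
    escape ys (K , below) = witness (stage-meets (m≤n⊔m K i))
      where
      witness : (∃ λ s → s ∈ chosen (stage (suc (K ⊔ i))) ×
                         Avoiding (chosen (stage (K ⊔ i))) (target i) s) →
                ∃ λ s → (Chosen ∩ A (target i)) s × s ∉ ys
      witness (s , s∈ , As , s∥chosen) = s , ((suc (K ⊔ i) , s∈) , As) , λ s∈ys →
        All.lookup s∥chosen (mono (m≤m⊔n K i) (below (s∈ys , suc (K ⊔ i) , s∈))) Comparable-refl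

  Chosen-meets-infinitely-many : Infinite (λ n → Infinite (Chosen ∩ A n))
  Chosen-meets-infinitely-many =
    unbounded⇒Infinite λ k → target k , proj₁ (proj₂ (next k)) , Chosen-meets-target k

lemma33 : ExcludedMiddle 0ℓ →
    (A : ℕ → Seq → Set) →
    (∀ n → Antichain (A n)) →
    (∀ n → Infinite (A n)) →
    ∃ λ (B : Seq → Set) →
    Antichain B × Infinite (λ n → Infinite (λ s → B s × A n s))
lemma33 em A A-antichain A-infinite = Chosen , Chosen-antichain , Chosen-meets-infinitely-many
  where open Construction em A A-antichain A-infinite
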